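{- $R(B_2, B_{10}) \geq 25$.
   Context: For graphs $G,H$, the Ramsey number $R(G,H)$ is the smallest $n$ such that every red-blue edge-coloring of $K_n$ contains a red copy of $G$ or a blue copy of $H$ (copies as subgraphs, not necessarily induced). The book $B_k$ is the graph on $k+2$ vertices consisting of an edge $uv$ together with $k$ further vertices, each adjacent exactly to $u$ and $v$. -}

module Defs where

open import Data.Nat using (ℕ; zero; suc; _+_; _≤_)
open import Data.Unit using (⊤)
open import Data.Fin using (Fin; zero; suc)
open import Data.Bool using (Bool; true; false)
open import Data.Product using (Σ; _×_; _,_)
open import Data.Sum using (_⊎_)
open import Relation.Binary.PropositionalEquality using (_≡_)
open import Relation.Nullary using (¬_)
open import Function.Definitions using (Injective)

record Graph (k : ℕ) : Set where
  field
    adj   : Fin k → Fin k → Bool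
    sym   : ∀ i j → adj i j ≡ adj j i
    irrefl : ∀ i → adj i i ≡ false
open Graph public

-- The book B_m on m+2 vertices: vertices 0 and 1 form the spine uv,
-- the remaining m vertices (pages) are each adjacent exactly to 0 and 1.
bookAdj : {m : ℕ} → Fin (suc (suc m)) → Fin (suc (suc m)) → Bool
bookAdj zero zero = false
bookAdj zero (suc _) = true
bookAdj (suc _) zero = true
bookAdj (suc zero) (suc zero) = false
bookAdj (suc zero) (suc (suc _)) = true
bookAdj (suc (suc _)) (suc zero) = true
bookAdj (suc (suc _)) (suc (suc _)) = false

bookAdj-sym : {m : ℕ} → (i j : Fin (suc (suc m))) → bookAdj i j ≡ bookAdj j i
bookAdj-sym zero zero = Relation.Binary.PropositionalEquality.refl
bookAdj-sym zero (suc _) = Relation.Binary.PropositionalEquality.refl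
bookAdj-sym (suc _) zero = Relation.Binary.PropositionalEquality.refl
bookAdj-sym (suc zero) (suc zero) = Relation.Binary.PropositionalEquality.refl
bookAdj-sym (suc zero) (suc (suc _)) = Relation.Binary.PropositionalEquality.refl
bookAdj-sym (suc (suc _)) (suc zero) = Relation.Binary.PropositionalEquality.refl
bookAdj-sym (suc (suc _)) (suc (suc _)) = Relation.Binary.PropositionalEquality.refl

bookAdj-irrefl : {m : ℕ} → (i : Fin (suc (suc m))) → bookAdj i i ≡ false
bookAdj-irrefl zero = Relation.Binary.PropositionalEquality.refl
bookAdj-irrefl (suc zero) = Relation.Binary.PropositionalEquality.refl
bookAdj-irrefl (suc (suc _)) = Relation.Binary.PropositionalEquality.refl

Book : (m : ℕ) → Graph (suc (suc m))
Book m = record { adj = bookAdj ; sym = bookAdj-sym ; irrefl = bookAdj-irrefl }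

data Colour : Set where
  red blue : Colour

-- A red-blue edge-colouring of K_n: a symmetric colour assignment to pairs
-- (the value on the diagonal is irrelevant: only distinct pairs are used).
record Colouring (n : ℕ) : Set where
  field
    col : Fin n → Fin n → Colour
    col-sym : ∀ x y → col x y ≡ col y x
open Colouring public

MonoCopy : {k n : ℕ} → Colour → Graph k → Colouring n → Set
MonoCopy {k} {n} κ G c =
  Σ (Fin k → Fin n) λ f → Injective _≡_ _≡_ f ×
    (∀ i j → adj G i j ≡ true → col c (f i) (f j) ≡ κ)

Arrows : {k l : ℕ} → ℕ → Graph k → Graph l → Set
Arrows n G H = (c : Colouring n) → MonoCopy red G c ⊎ MonoCopy blue H c

-- R(G,H) ≥ N: R(G,H) is the least n with K_n → (G,H), so R(G,H) ≥ N
-- means no n < N arrows (G,H).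
RamseyAtLeast : {k l : ℕ} → Graph k → Graph l → ℕ → Set
RamseyAtLeast G H zero = ⊤
RamseyAtLeast G H (suc N) = ∀ n → n ≤ N → ¬ Arrows n G H

{-# OPTIONS --safe #-}
module Submission where

open import Defs hiding (sym)
open import Data.Bool using (if_then_else_)
open import Data.Char using (Char)
open import Data.Fin using (Fin; zero; suc; punchOut; punchIn; inject≤)
open import Data.Fin.Properties
  using (_≟_; all?; any?; punchOut-injective; punchIn-punchOut; punchIn-injective; punchInᵢ≢i; inject≤-injective; suc-injective)
open import Data.Nat using (ℕ; zero; suc; _≤_; _≤?_; z≤n; s≤s)
open import Data.Nat.Properties using (≤-refl; ≤-trans; n≤1+n; 1+n≰n)
open import Data.Product using (_×_; _,_)
open import Data.String using (toVec; fromChar; _==_)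
open import Data.Sum using (inj₁; inj₂)
open import Data.Unit using (tt)
open import Data.Vec using (Vec; _∷_; []; lookup)
open import Function using (_∘_)
open import Function.Definitions using (Injective)
open import Level using (Level; 0ℓ)
open import Relation.Binary.Definitions using (DecidableEquality)
open import Relation.Binary.PropositionalEquality using (_≡_; _≢_; refl; sym; trans; subst)
open import Relation.Nullary using (¬_; Dec; yes; no; does; ¬?; contradiction)
open import Relation.Nullary.Decidable using (_×-dec_; _→-dec_; toWitness)
open import Relation.Unary using (Pred; Decidable)

-- A monochromatic book B_k with spine xy exhibits k distinct common neighbours of x and y
-- in its colour. So it suffices to find a colouring of K_24 in which every red edge has at
-- most one common red neighbour and every blue edge at most nine common blue neighbours.
-- The red graph of such a colouring is 9-regular with every edge in at most one triangle;
-- both codegree bounds are decidable and are verified by computation.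

count : ∀ {n p} {P : Pred (Fin n) p} → Decidable P → ℕ
count {zero}  P? = 0
count {suc n} P? = if does (P? zero) then suc (count (P? ∘ suc)) else count (P? ∘ suc)

module _ {p : Level} where

  count-suc≤count : ∀ {n} {P : Pred (Fin (suc n)) p} (P? : Decidable P) → count (P? ∘ suc) ≤ count P?
  count-suc≤count P? with P? zero
  ... | yes _ = n≤1+n _
  ... | no  _ = ≤-refl

  count-yes : ∀ {n} {P : Pred (Fin (suc n)) p} (P? : Decidable P) →
              P zero → count P? ≡ suc (count (P? ∘ suc))
  count-yes P? P0 with P? zero
  ... | yes _  = refl
  ... | no ¬P0 = contradiction P0 ¬P0

  injection⇒≤count : ∀ {m n} {P : Pred (Fin n) p} (P? : Decidable P) (g : Fin m → Fin n) →
                     Injective _≡_ _≡_ g → (∀ i → P (g i)) → m ≤ count P?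

  injection-avoiding-0⇒≤count-suc :
    ∀ {m n} {P : Pred (Fin (suc n)) p} (P? : Decidable P) (g : Fin m → Fin (suc n)) →
    Injective _≡_ _≡_ g → (∀ i → zero ≢ g i) → (∀ i → P (g i)) → m ≤ count (P? ∘ suc)
  injection-avoiding-0⇒≤count-suc {P = P} P? g inj g≢0 Pg =
    injection⇒≤count (P? ∘ suc) (λ i → punchOut (g≢0 i))
      (λ e → inj (punchOut-injective (g≢0 _) (g≢0 _) e))
      (λ i → subst P (sym (punchIn-punchOut (g≢0 i))) (Pg i))

  injection⇒≤count {zero}  P? g inj Pg = z≤n
  injection⇒≤count {suc m} {zero}  P? g inj Pg with g zero
  ... | ()
  injection⇒≤count {suc m} {suc n} {P} P? g inj Pg with any? (λ i → g i ≟ zero)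
  ... | no  g≢0 = ≤-trans (injection-avoiding-0⇒≤count-suc P? g inj (λ i 0≡gi → g≢0 (i , sym 0≡gi)) Pg)
                          (count-suc≤count P?)
  ... | yes (i₀ , gi₀≡0) = subst (suc m ≤_) (sym (count-yes P? (subst P gi₀≡0 (Pg i₀))))
    (s≤s (injection-avoiding-0⇒≤count-suc P? (g ∘ punchIn i₀)
            (punchIn-injective i₀ _ _ ∘ inj) g∘punchIn≢0 (Pg ∘ punchIn i₀)))
    where
    g∘punchIn≢0 : ∀ i → zero ≢ g (punchIn i₀ i)
    g∘punchIn≢0 i 0≡g = punchInᵢ≢i i₀ i (inj (trans (sym 0≡g) (sym gi₀≡0)))

_≟ᶜ_ : DecidableEquality Colour
red  ≟ᶜ red  = yes refl
red  ≟ᶜ blue = no λ ()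
blue ≟ᶜ red  = no λ ()
blue ≟ᶜ blue = yes refl

module _ {n : ℕ} (c : Colouring n) (κ : Colour) where

  CommonNeighbour : Fin n → Fin n → Pred (Fin n) 0ℓ
  CommonNeighbour x y z = x ≢ z × y ≢ z × col c x z ≡ κ × col c y z ≡ κ

  commonNeighbour? : ∀ x y → Decidable (CommonNeighbour x y)
  commonNeighbour? x y z = ¬? (x ≟ z) ×-dec ¬? (y ≟ z) ×-dec col c x z ≟ᶜ κ ×-dec col c y z ≟ᶜ κ

  codegree : Fin n → Fin n → ℕ
  codegree x y = count (commonNeighbour? x y)

  CodegreeAtMost : ℕ → Set
  CodegreeAtMost d = ∀ x y → x ≢ y → col c x y ≡ κ → codegree x y ≤ d

  codegreeAtMost? : ∀ d → Dec (CodegreeAtMost d)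
  codegreeAtMost? d = all? λ x → all? λ y → ¬? (x ≟ y) →-dec col c x y ≟ᶜ κ →-dec codegree x y ≤? d

  pages≤codegree-spine : ∀ {k} ((f , _ , _) : MonoCopy κ (Book k) c) → k ≤ codegree (f zero) (f (suc zero))
  pages≤codegree-spine (f , inj , mono) =
    injection⇒≤count (commonNeighbour? _ _) (λ i → f (suc (suc i)))
      (λ e → suc-injective (suc-injective (inj e)))
      (λ i → (λ e → contradiction (inj e) λ ()) , (λ e → contradiction (inj e) λ ())
           , mono zero (suc (suc i)) refl , mono (suc zero) (suc (suc i)) refl)

  codegreeAtMost⇒¬Book : ∀ {k} → CodegreeAtMost k → ¬ MonoCopy κ (Book (suc k)) c
  codegreeAtMost⇒¬Book bound copy@(f , inj , mono) = 1+n≰n (≤-trans (pages≤codegree-spine copy)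
    (bound (f zero) (f (suc zero)) (λ e → contradiction (inj e) λ ()) (mono zero (suc zero) refl)))

restrict : ∀ {m n} → m ≤ n → Colouring n → Colouring m
restrict m≤n c = record
  { col     = λ x y → col c (inject≤ x m≤n) (inject≤ y m≤n)
  ; col-sym = λ x y → col-sym c (inject≤ x m≤n) (inject≤ y m≤n)
  }

copy-in-restrict : ∀ {k m n κ} {G : Graph k} (m≤n : m ≤ n) (c : Colouring n) →
                   MonoCopy κ G (restrict m≤n c) → MonoCopy κ G c
copy-in-restrict m≤n c (f , inj , mono) =
  (λ i → inject≤ (f i) m≤n) , inj ∘ inject≤-injective m≤n m≤n _ _ , mono

avoiding⇒RamseyAtLeast : ∀ {k l N} (G : Graph k) (H : Graph l) (c : Colouring N) →
                         ¬ MonoCopy red G c → ¬ MonoCopy blue H c → RamseyAtLeast G H (suc N)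
avoiding⇒RamseyAtLeast G H c ¬red ¬blue n n≤N arrows with arrows (restrict n≤N c)
... | inj₁ redCopy  = ¬red  (copy-in-restrict {G = G} n≤N c redCopy)
... | inj₂ blueCopy = ¬blue (copy-in-restrict {G = H} n≤N c blueCopy)

redGraph : Vec (Vec Char 24) 24
redGraph
  = toVec "..1.....11..11..1..1..11"
  ∷ toVec "...1.....11.1..111...11."
  ∷ toVec "1.........11..11.11.11.."
  ∷ toVec ".1......1..1.11...111..1"
  ∷ toVec "......1...1111..11..1..1"
  ∷ toVec ".......1.11..11.1..111.."
  ∷ toVec "....1...11....11..11.11."
  ∷ toVec ".....1..1..11..1.11...11"
  ∷ toVec "1..1..11..1.....11..11.."
  ∷ toVec "11...11....1.....11.1..1"
  ∷ toVec ".11.11..1.........11..11"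
  ∷ toVec "..111..1.1......1..1.11."
  ∷ toVec "11..1..1......1...1111.."
  ∷ toVec "1..111.........1.11..11."
  ∷ toVec "..11.11.....1...11....11"
  ∷ toVec ".11...11.....1..1..11..1"
  ∷ toVec "11..11..1..1..11..1....."
  ∷ toVec ".11.1..111...11....1...."
  ∷ toVec "..11..11.11.11..1......."
  ∷ toVec "1..1.11...111..1.1......"
  ∷ toVec "..1111..11..1..1......1."
  ∷ toVec ".11..11.1..111.........1"
  ∷ toVec "11....11..11.11.....1..."
  ∷ toVec "1..11..1.11...11.....1.."
  ∷ []

colour24 : Fin 24 → Fin 24 → Colour
colour24 x y = if fromChar (lookup (lookup redGraph x) y) == "1" then red else blue

colouring24 : Colouring 24
colouring24 = record
  { col     = colour24
  ; col-sym = toWitness {a? = all? λ x → all? λ y → colour24 x y ≟ᶜ colour24 y x} tt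
  }

colouring24-red-codegree≤1 : CodegreeAtMost colouring24 red 1
colouring24-red-codegree≤1 = toWitness {a? = codegreeAtMost? colouring24 red 1} tt

colouring24-blue-codegree≤9 : CodegreeAtMost colouring24 blue 9
colouring24-blue-codegree≤9 = toWitness {a? = codegreeAtMost? colouring24 blue 9} tt

mainTheorem5 : RamseyAtLeast (Book 2) (Book 10) 25
mainTheorem5 = avoiding⇒RamseyAtLeast (Book 2) (Book 10) colouring24
  (codegreeAtMost⇒¬Book colouring24 red colouring24-red-codegree≤1)
  (codegreeAtMost⇒¬Book colouring24 blue colouring24-blue-codegree≤9)
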